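{- Let $p=(12,\{(0,0),(0,1),(0,2),(1,1),(1,2),(2,0),(2,1)\})$ and $n\ge 2$. For each $1\le k\le n-1$, the number of permutations $\pi\in S_n$ with $\pi_1=k$ that contain $p$ is $(k-1)!\,(n-k-1)!$. Consequently \[|S_n(p)| = n!-\sum_{k=1}^{n-1}(k-1)!\,(n-k-1)!.\]
   Context: $S_n$ is the set of permutations of $\{1,\dots,n\}$, written $\pi=\pi_1\cdots\pi_n$. A mesh pattern $(12,R)$ of length 2 has $R\subseteq\{0,1,2\}^2$ (shaded boxes). A permutation $\pi\in S_n$ contains $(12,R)$ if there exist indices $i<j$ with $\pi_i<\pi_j$ such that, with $p_0=0,p_1=i,p_2=j,p_3=n+1$ and $v_0=0,v_1=\pi_i,v_2=\pi_j,v_3=n+1$, for every $(a,b)\in R$ there is no index $x$ with $p_a<x<p_{a+1}$ and $v_b<\pi_x<v_{b+1}$. Otherwise $\pi$ avoids it; $S_n(p)$ is the set of avoiders in $S_n$. -}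

module Defs where

open import Data.Nat using (ℕ; zero; suc; _+_; _*_; _∸_; _<_; _≤_)
open import Data.Fin using (Fin; toℕ; inject₁) renaming (zero to fz; suc to fs)
open import Data.Vec using (Vec; lookup)
open import Data.List using (List; []; _∷_; length)
open import Data.List.Membership.Propositional using (_∈_)
open import Data.List.Relation.Unary.Unique.Propositional using (Unique)
open import Data.Product using (Σ; _×_; _,_; ∃)
open import Relation.Binary.PropositionalEquality using (_≡_)
open import Relation.Nullary using (¬_)
open import Function.Bundles using (_⇔_)

-- A permutation π = π₁⋯πₙ of {1,…,n} is a vector of length n over Fin n
-- (entry at Fin-index x is π_{x+1} - 1) whose lookup is injective
-- (hence bijective, Fin n being finite).
IsPerm : {n : ℕ} → Vec (Fin n) n → Set
IsPerm {n} π = (i j : Fin n) → lookup π i ≡ lookup π j → i ≡ j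

pos : {n : ℕ} → Fin n → ℕ
pos x = suc (toℕ x)

val : {n : ℕ} → Vec (Fin n) n → Fin n → ℕ
val π x = suc (toℕ (lookup π x))

-- A mesh pattern (12, R) with R given as a list of boxes (a , b), a,b ∈ {0,1,2}.
-- a indexes the horizontal (position) strip, b the vertical (value) strip.
Box : Set
Box = Fin 3 × Fin 3

-- boundaries p₀..p₃ and v₀..v₃ for an occurrence at 1-based positions i<j
-- with 1-based values u<w; an element (x-position q, value v) lies in box (a,b)
-- iff p_a < q < p_{a+1} and v_b < v < v_{b+1}.
bound : ℕ → ℕ → ℕ → Fin 4 → ℕ
bound n i j fz = 0
bound n i j (fs fz) = i
bound n i j (fs (fs fz)) = j
bound n i j (fs (fs (fs fz))) = suc n

InBox : ℕ → ℕ → ℕ → ℕ → ℕ → Box → ℕ → ℕ → Set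
InBox n i j u w (a , b) q v =
  (bound n i j (inject₁ a) < q × q < bound n i j (fs a)) ×
  (bound n u w (inject₁ b) < v × v < bound n u w (fs b))

Contains : {n : ℕ} → List Box → Vec (Fin n) n → Set
Contains {n} R π =
  Σ (Fin n) λ i → Σ (Fin n) λ j →
    pos i < pos j × val π i < val π j ×
    ((box : Box) → box ∈ R → (x : Fin n) →
      ¬ InBox n (pos i) (pos j) (val π i) (val π j) box (pos x) (val π x))

pR : List Box
pR = (f0 , f0) ∷ (f0 , f1) ∷ (f0 , f2) ∷ (f1 , f1) ∷ (f1 , f2) ∷ (f2 , f0) ∷ (f2 , f1) ∷ []
  where
  f0 f1 f2 : Fin 3
  f0 = fz
  f1 = fs fz
  f2 = fs (fs fz)

FirstIs : {n : ℕ} → Vec (Fin n) n → ℕ → Set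
FirstIs {n} π k = Σ (Fin n) λ x → toℕ x ≡ 0 × val π x ≡ k

HasCard : {A : Set} → (A → Set) → ℕ → Set
HasCard {A} P m =
  Σ (List A) λ xs → Unique xs × length xs ≡ m × ((a : A) → (a ∈ xs ⇔ P a))

_! : ℕ → ℕ
zero ! = 1
suc n ! = suc n * n !

sumFrom : ℕ → ℕ → (ℕ → ℕ) → ℕ
sumFrom lo zero f = 0
sumFrom lo (suc c) f = f lo + sumFrom (suc lo) c f

sumRange : ℕ → ℕ → (ℕ → ℕ) → ℕ
sumRange lo hi f = sumFrom lo (suc hi ∸ lo) f

-- An occurrence (i, j) of p in a permutation π is forced into the shape π = k α (k+1) β, where α
-- permutes {1, …, k-1} and β permutes {k+2, …, n}.  The shaded first column forces i = 1; the shaded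
-- boxes (1,1), (1,2) put every entry between the two below π_i, and (2,0), (2,1) put every entry after
-- j above π_j.  Comparing numbers of positions and of available values (π is injective) then gives
-- j = π_i + 1 = π_j.  Conversely every permutation of this shape contains p at positions 1 and k+1.
-- The permutations with π₁ = k containing p are thus the direct sums of a permutation of S_k starting
-- with k and one of S_{n-k} starting with 1, which gives (k-1)! (n-k-1)!; summing over k and taking
-- the complement in S_n gives |S_n(p)|.

module Submission where

open import Defs
open import Data.Nat using (ℕ; _≤_; _∸_; _*_)
open import Data.Fin using (Fin)
open import Data.Vec using (Vec)
open import Data.Product using (_×_)
open import Relation.Nullary using (¬_)

open import Data.Nat using (zero; suc; _+_; _<_; z≤n; s≤s; s≤s⁻¹; z<s)
open import Data.Nat.Properties
open import Data.Fin using (toℕ; fromℕ; fromℕ<; punchIn; punchOut; _↑ˡ_; _↑ʳ_; splitAt)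
  renaming (zero to fz; suc to fs)
open import Data.Fin.Properties
  using (toℕ-injective; toℕ<n; toℕ-fromℕ; toℕ-fromℕ<; toℕ-↑ˡ; toℕ-↑ʳ; ↑ˡ-injective; ↑ʳ-injective;
         splitAt⁻¹-↑ˡ; splitAt⁻¹-↑ʳ; punchIn-injective; punchInᵢ≢i;
         punchIn-punchOut; injective⇒≤)
  renaming (_≟_ to _≟ᶠ_; suc-injective to fs-injective)
open import Data.Vec using ([]; _∷_; lookup; tabulate; head; map; _++_)
open import Data.Vec.Properties
  using (lookup-map; lookup∘tabulate; tabulate∘lookup; tabulate-cong; lookup-++ˡ; lookup-++ʳ;
         ∷-injective; ++-injective; ≡-dec)
open import Data.List as L using (List; []; _∷_; length; filter; cartesianProductWith; allFin)
open import Data.List.Properties using (length-++; length-map; length-tabulate)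
open import Data.List.Membership.Propositional using (_∈_)
open import Data.List.Membership.Propositional.Properties
  using (++-∈⇔; ∈-filter⁺; ∈-filter⁻; ∈-cartesianProductWith⁺; ∈-cartesianProductWith⁻; ∈-allFin)
open import Data.List.Membership.Propositional.Properties.WithK using (unique∧set⇒bag)
import Data.List.Membership.DecPropositional as DecMembership
open import Data.List.Relation.Unary.Any using (here; there)
open import Data.List.Relation.Unary.All using ([])
open import Data.List.Relation.Unary.AllPairs using ([]; _∷_)
open import Data.List.Relation.Unary.Unique.Propositional.Properties
  using (++⁺; filter⁺; cartesianProductWith⁺; allFin⁺)
open import Data.List.Relation.Binary.BagAndSetEquality using (∼bag⇒↭)
open import Data.List.Relation.Binary.Permutation.Propositional.Properties using (↭-length)
open import Data.Product using (Σ; ∃; _,_; proj₁; proj₂)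
open import Data.Sum using (_⊎_; inj₁; inj₂; [_,_])
open import Data.Sum.Function.Propositional using (_⊎-⇔_)
open import Data.Unit using (⊤; tt)
open import Data.Empty using (⊥; ⊥-elim)
open import Function using (_∘_)
open import Function.Bundles using (mk⇔; Equivalence)
import Function.Properties.Equivalence as ⇔
open import Relation.Binary.Definitions using (DecidableEquality; tri<; tri≈; tri>)
open import Relation.Binary.PropositionalEquality hiding ([_]; J)
open import Relation.Nullary using (yes; no; ¬?)

private
  variable
    A B C : Set
    m n l N : ℕ

-- Counting

HasCard-cong : {P Q : A → Set} → (∀ a → P a → Q a) → (∀ a → Q a → P a) → HasCard P m → HasCard Q m
HasCard-cong to from (xs , xs! , len , xs∈) =
  xs , xs! , len , λ a → mk⇔ (to a ∘ Equivalence.to (xs∈ a)) (Equivalence.from (xs∈ a) ∘ from a)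

HasCard-unique : {P : A → Set} → HasCard P m → HasCard P l → m ≡ l
HasCard-unique (xs , xs! , refl , xs∈) (ys , ys! , refl , ys∈) =
  ↭-length (∼bag⇒↭ (unique∧set⇒bag xs! ys! λ {a} → ⇔.trans (xs∈ a) (⇔.sym (ys∈ a))))

HasCard-empty : {P : A → Set} → (∀ a → ¬ P a) → HasCard P 0
HasCard-empty ¬P = [] , [] , refl , λ a → mk⇔ (λ ()) (⊥-elim ∘ ¬P a)

HasCard-⊎ : {P Q : A → Set} → (∀ a → P a → Q a → ⊥) →
            HasCard P m → HasCard Q l → HasCard (λ a → P a ⊎ Q a) (m + l)
HasCard-⊎ disjoint (xs , xs! , refl , xs∈) (ys , ys! , refl , ys∈) =
  xs L.++ ys ,
  ++⁺ xs! ys! (λ (a∈xs , a∈ys) → disjoint _ (Equivalence.to (xs∈ _) a∈xs) (Equivalence.to (ys∈ _) a∈ys)) ,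
  length-++ xs ,
  λ a → ⇔.trans ++-∈⇔ (xs∈ a ⊎-⇔ ys∈ a)

HasCard-sumFrom : (Q : ℕ → A → Set) (f : ℕ → ℕ) → (∀ {k k′ a} → Q k a → Q k′ a → k ≡ k′) →
  ∀ lo c → (∀ k → lo ≤ k → k < lo + c → HasCard (Q k) (f k)) →
  HasCard (λ a → Σ ℕ λ k → lo ≤ k × k < lo + c × Q k a) (sumFrom lo c f)
HasCard-sumFrom Q f determined lo zero _ =
  HasCard-empty λ a (k , lo≤k , k<lo+0 , _) → <⇒≱ k<lo+0 (≤-trans (≤-reflexive (+-identityʳ lo)) lo≤k)
HasCard-sumFrom Q f determined lo (suc c) card =
  HasCard-cong (λ _ → [ first , later ]) split
    (HasCard-⊎ disjoint (card lo ≤-refl lo<lo+1+c) (HasCard-sumFrom Q f determined (suc lo) c card′))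
  where
  lo<lo+1+c : lo < lo + suc c
  lo<lo+1+c = m<m+n lo z<s
  card′ : ∀ k → suc lo ≤ k → k < suc lo + c → HasCard (Q k) (f k)
  card′ k lo<k k<1+lo+c = card k (<⇒≤ lo<k) (subst (k <_) (sym (+-suc lo c)) k<1+lo+c)
  disjoint : ∀ a → Q lo a → (Σ ℕ λ k → suc lo ≤ k × k < suc lo + c × Q k a) → ⊥
  disjoint a q (k , lo<k , _ , q′) = <-irrefl (determined q q′) lo<k
  first : ∀ {a} → Q lo a → Σ ℕ λ k → lo ≤ k × k < lo + suc c × Q k a
  first q = lo , ≤-refl , lo<lo+1+c , q
  later : ∀ {a} → (Σ ℕ λ k → suc lo ≤ k × k < suc lo + c × Q k a) →
          Σ ℕ λ k → lo ≤ k × k < lo + suc c × Q k a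
  later (k , lo<k , k<1+lo+c , q) = k , <⇒≤ lo<k , subst (k <_) (sym (+-suc lo c)) k<1+lo+c , q
  split : ∀ a → (Σ ℕ λ k → lo ≤ k × k < lo + suc c × Q k a) →
          Q lo a ⊎ (Σ ℕ λ k → suc lo ≤ k × k < suc lo + c × Q k a)
  split a (k , lo≤k , k<lo+1+c , q) with m≤n⇒m<n∨m≡n lo≤k
  ... | inj₁ lo<k = inj₂ (k , lo<k , subst (k <_) (+-suc lo c) k<lo+1+c , q)
  ... | inj₂ refl = inj₁ q

-- C need not be decidable: on P it is decided by membership in the list enumerating P ∩ C.
HasCard-∖ : DecidableEquality A → {P C : A → Set} →
            HasCard P N → HasCard (λ a → P a × C a) m → HasCard (λ a → P a × ¬ C a) (N ∸ m)
HasCard-∖ {A = A} {N = N} {m = m} _≟_ {P} {C} cardP@(as , as! , _ , as∈) cardP∩C@(bs , _ , _ , bs∈) =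
  subst (HasCard _) rest≡N∸m cardP∖C
  where
  open DecMembership _≟_ using (_∈?_)
  rest : List A
  rest = filter (¬? ∘ (_∈? bs)) as
  cardP∖C : HasCard (λ a → P a × ¬ C a) (length rest)
  cardP∖C = rest , filter⁺ _ as! , refl , λ a → mk⇔ (to a) (from a)
    where
    to : ∀ a → a ∈ rest → P a × ¬ C a
    to a a∈rest with a∈as , a∉bs ← ∈-filter⁻ (¬? ∘ (_∈? bs)) a∈rest =
      Equivalence.to (as∈ a) a∈as , λ c → a∉bs (Equivalence.from (bs∈ a) (Equivalence.to (as∈ a) a∈as , c))
    from : ∀ a → P a × ¬ C a → a ∈ rest
    from a (p , ¬c) =
      ∈-filter⁺ (¬? ∘ (_∈? bs)) (Equivalence.from (as∈ a) p) (¬c ∘ proj₂ ∘ Equivalence.to (bs∈ a))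
  decide : ∀ a → P a → (P a × C a) ⊎ (P a × ¬ C a)
  decide a p with a ∈? bs
  ... | yes a∈bs = inj₁ (Equivalence.to (bs∈ a) a∈bs)
  ... | no a∉bs = inj₂ (p , λ c → a∉bs (Equivalence.from (bs∈ a) (p , c)))
  m+rest≡N : m + length rest ≡ N
  m+rest≡N = HasCard-unique
    (HasCard-cong (λ _ → [ proj₁ , proj₁ ]) decide (HasCard-⊎ (λ _ (_ , c) (_ , ¬c) → ¬c c) cardP∩C cardP∖C))
    cardP
  rest≡N∸m : length rest ≡ N ∸ m
  rest≡N∸m = trans (sym (m+n∸m≡n m _)) (cong (_∸ m) m+rest≡N)

length-cartesianProductWith : (f : A → B → C) (xs : List A) (ys : List B) →
                              length (cartesianProductWith f xs ys) ≡ length xs * length ys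
length-cartesianProductWith f [] ys = refl
length-cartesianProductWith f (x ∷ xs) ys = begin
  length (L.map (f x) ys L.++ cartesianProductWith f xs ys)
    ≡⟨ length-++ (L.map (f x) ys) ⟩
  length (L.map (f x) ys) + length (cartesianProductWith f xs ys)
    ≡⟨ cong₂ _+_ (length-map (f x) ys) (length-cartesianProductWith f xs ys) ⟩
  length ys + length xs * length ys ∎
  where open ≡-Reasoning

HasCard-image₂ : {P : A → Set} {Q : B → Set} {R : C → Set} (f : A → B → C) →
  (∀ {a a′ b b′} → f a b ≡ f a′ b′ → a ≡ a′ × b ≡ b′) →
  (∀ a b → P a → Q b → R (f a b)) →
  (∀ c → R c → Σ A λ a → Σ B λ b → P a × Q b × c ≡ f a b) →
  HasCard P m → HasCard Q l → HasCard R (m * l)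
HasCard-image₂ {R = R} f f-injective f-into f-onto (xs , xs! , refl , xs∈) (ys , ys! , refl , ys∈) =
  cartesianProductWith f xs ys ,
  cartesianProductWith⁺ f f-injective xs! ys! ,
  length-cartesianProductWith f xs ys ,
  λ c → mk⇔ (to c) (from c)
  where
  to : ∀ c → c ∈ cartesianProductWith f xs ys → R c
  to c c∈ with a , b , a∈xs , b∈ys , refl ← ∈-cartesianProductWith⁻ f xs ys c∈ =
    f-into a b (Equivalence.to (xs∈ a) a∈xs) (Equivalence.to (ys∈ b) b∈ys)
  from : ∀ c → R c → c ∈ cartesianProductWith f xs ys
  from c r with a , b , p , q , refl ← f-onto c r =
    ∈-cartesianProductWith⁺ f (Equivalence.from (xs∈ a) p) (Equivalence.from (ys∈ b) q)

HasCard-Fin : HasCard (λ (_ : Fin n) → ⊤) n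
HasCard-Fin {n} = allFin n , allFin⁺ n , length-tabulate (λ x → x) , λ x → mk⇔ (λ _ → tt) (λ _ → ∈-allFin x)

interval-injection-≤ : ∀ {lo hi lo′ hi′} (f : Fin n → ℕ) → (∀ {x y} → f x ≡ f y → x ≡ y) → hi ≤ n →
  (∀ x → lo ≤ toℕ x → toℕ x < hi → lo′ ≤ f x × f x < hi′) → hi ∸ lo ≤ hi′ ∸ lo′
interval-injection-≤ {n} {lo} {hi} {lo′} {hi′} f f-inj hi≤n maps = injective⇒≤ g-injective
  where
  t+lo<hi : (t : Fin (hi ∸ lo)) → toℕ t + lo < hi
  t+lo<hi t = m≤o∸n⇒m+n≤o (suc (toℕ t)) (<⇒≤ lo<hi) (toℕ<n t)
    where
    lo<hi : lo < hi
    lo<hi = m∸n≢0⇒n<m λ eq → n≮0 (subst (toℕ t <_) eq (toℕ<n t))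
  position : Fin (hi ∸ lo) → Fin n
  position t = fromℕ< (≤-trans (t+lo<hi t) hi≤n)
  position-maps : ∀ t → lo′ ≤ f (position t) × f (position t) < hi′
  position-maps t = maps (position t) (subst (lo ≤_) (sym (toℕ-fromℕ< _)) (m≤n+m lo _))
                                      (subst (_< hi) (sym (toℕ-fromℕ< _)) (t+lo<hi t))
  g : Fin (hi ∸ lo) → Fin (hi′ ∸ lo′)
  g t = fromℕ< (∸-monoˡ-< (proj₂ (position-maps t)) (proj₁ (position-maps t)))
  g-injective : ∀ {s t} → g s ≡ g t → s ≡ t
  g-injective {s} {t} eq = toℕ-injective (+-cancelʳ-≡ lo _ _ (begin
    toℕ s + lo              ≡⟨ toℕ-fromℕ< _ ⟨
    toℕ (position s)        ≡⟨ cong toℕ (f-inj f-equal) ⟩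
    toℕ (position t)        ≡⟨ toℕ-fromℕ< _ ⟩
    toℕ t + lo              ∎))
    where
    open ≡-Reasoning
    f-equal : f (position s) ≡ f (position t)
    f-equal = begin
      f (position s)                ≡⟨ m∸n+n≡m (proj₁ (position-maps s)) ⟨
      f (position s) ∸ lo′ + lo′    ≡⟨ cong (_+ lo′) (trans (sym (toℕ-fromℕ< _))
                                                            (trans (cong toℕ eq) (toℕ-fromℕ< _))) ⟩
      f (position t) ∸ lo′ + lo′    ≡⟨ m∸n+n≡m (proj₁ (position-maps t)) ⟩
      f (position t)                ∎

-- Permutations

lookup-injective : {xs ys : Vec A n} → (∀ i → lookup xs i ≡ lookup ys i) → xs ≡ ys
lookup-injective {xs = xs} {ys} xs≗ys =
  trans (sym (tabulate∘lookup xs)) (trans (tabulate-cong xs≗ys) (tabulate∘lookup ys))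

map-injective : {f : A → B} → (∀ {x y} → f x ≡ f y → x ≡ y) →
                {xs ys : Vec A n} → map f xs ≡ map f ys → xs ≡ ys
map-injective f-inj {[]} {[]} _ = refl
map-injective f-inj {x ∷ xs} {y ∷ ys} eq with fx≡fy , rest ← ∷-injective eq =
  cong₂ _∷_ (f-inj fx≡fy) (map-injective f-inj rest)

prepend : Fin (suc n) → Vec (Fin n) n → Vec (Fin (suc n)) (suc n)
prepend v σ = v ∷ map (punchIn v) σ

IsPerm-prepend : (v : Fin (suc n)) {σ : Vec (Fin n) n} → IsPerm σ → IsPerm (prepend v σ)
IsPerm-prepend v σ! fz fz _ = refl
IsPerm-prepend v {σ} σ! fz (fs j) eq = ⊥-elim (punchInᵢ≢i v (lookup σ j) (sym (trans eq (lookup-map j _ σ))))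
IsPerm-prepend v {σ} σ! (fs i) fz eq = ⊥-elim (punchInᵢ≢i v (lookup σ i) (trans (sym (lookup-map i _ σ)) eq))
IsPerm-prepend v {σ} σ! (fs i) (fs j) eq =
  cong fs (σ! i j (punchIn-injective v _ _ (trans (sym (lookup-map i _ σ)) (trans eq (lookup-map j _ σ)))))

prepend-injective : {v w : Fin (suc n)} {σ τ : Vec (Fin n) n} → prepend v σ ≡ prepend w τ → v ≡ w × σ ≡ τ
prepend-injective {v = v} eq with refl , rest ← ∷-injective eq = refl , map-injective (punchIn-injective v _ _) rest

prepend-tail : (π : Vec (Fin (suc n)) (suc n)) → IsPerm π →
               Σ (Vec (Fin n) n) λ σ → IsPerm σ × π ≡ prepend (head π) σ
prepend-tail {n} (v ∷ rest) π! = σ , σ! , π≡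
  where
  v∉rest : ∀ t → v ≢ lookup rest t
  v∉rest t eq with () ← π! fz (fs t) eq
  σ : Vec (Fin n) n
  σ = tabulate (λ t → punchOut (v∉rest t))
  π≡ : v ∷ rest ≡ prepend v σ
  π≡ = cong (v ∷_) (lookup-injective λ t → begin
    lookup rest t                             ≡⟨ punchIn-punchOut (v∉rest t) ⟨
    punchIn v (punchOut (v∉rest t))           ≡⟨ cong (punchIn v) (lookup∘tabulate _ t) ⟨
    punchIn v (lookup σ t)                    ≡⟨ lookup-map t (punchIn v) σ ⟨
    lookup (map (punchIn v) σ) t              ∎)
    where open ≡-Reasoning
  σ! : IsPerm σ
  σ! s t eq = fs-injective (subst IsPerm π≡ π! (fs s) (fs t)
    (trans (lookup-map s _ σ) (trans (cong (punchIn v) eq) (sym (lookup-map t _ σ)))))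

permutations : ∀ n → HasCard (λ (π : Vec (Fin n) n) → IsPerm π) (n !)
permutations zero = [] ∷ [] , [] ∷ [] , refl , λ { [] → mk⇔ (λ _ ()) (λ _ → here refl) }
permutations (suc n) =
  HasCard-image₂ prepend prepend-injective (λ v _ _ σ! → IsPerm-prepend v σ!)
    (λ π π! → let σ , σ! , π≡ = prepend-tail π π! in head π , σ , tt , σ! , π≡)
    HasCard-Fin (permutations n)

-- Direct sums

-- The 0-based value: val π x ≡ suc (π ⟨ x ⟩).
_⟨_⟩ : Vec (Fin n) n → Fin n → ℕ
π ⟨ x ⟩ = toℕ (lookup π x)

SplitsAt : ℕ → Vec (Fin n) n → Set
SplitsAt m π = (∀ x → toℕ x < m → π ⟨ x ⟩ < m) × (∀ x → m ≤ toℕ x → m ≤ π ⟨ x ⟩)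

data Split (m n : ℕ) : Fin (m + n) → Set where
  left  : (s : Fin m) → Split m n (s ↑ˡ n)
  right : (t : Fin n) → Split m n (m ↑ʳ t)

split : ∀ m {n} (x : Fin (m + n)) → Split m n x
split m x with splitAt m x in eq
... | inj₁ s = subst (Split m _) (splitAt⁻¹-↑ˡ eq) (left s)
... | inj₂ t = subst (Split m _) (splitAt⁻¹-↑ʳ eq) (right t)

↑ʳ≮ : ∀ m (t : Fin n) → ¬ toℕ (m ↑ʳ t) < m
↑ʳ≮ m t lt = m+n≮m m _ (subst (_< m) (toℕ-↑ʳ m t) lt)

↑ˡ≱ : ∀ (s : Fin m) n → ¬ m ≤ toℕ (s ↑ˡ n)
↑ˡ≱ s n ge = <⇒≱ (toℕ<n s) (subst (_ ≤_) (toℕ-↑ˡ s n) ge)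

↑ˡ≢↑ʳ : ∀ (s : Fin m) (t : Fin n) → s ↑ˡ n ≢ m ↑ʳ t
↑ˡ≢↑ʳ s t eq = ↑ˡ≱ s _ (subst (λ x → _ ≤ toℕ x) (sym eq) (subst (_ ≤_) (sym (toℕ-↑ʳ _ t)) (m≤m+n _ _)))

↑ˡ-onto : (v : Fin (m + n)) → toℕ v < m → Σ (Fin m) λ s → s ↑ˡ n ≡ v
↑ˡ-onto {m} v v<m with split m v
... | left s = s , refl
... | right t = ⊥-elim (↑ʳ≮ m t v<m)

↑ʳ-onto : (v : Fin (m + n)) → m ≤ toℕ v → Σ (Fin n) λ t → m ↑ʳ t ≡ v
↑ʳ-onto {m} v m≤v with split m v
... | left s = ⊥-elim (↑ˡ≱ s _ m≤v)
... | right t = t , refl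

_⊕_ : Vec (Fin m) m → Vec (Fin n) n → Vec (Fin (m + n)) (m + n)
_⊕_ {m} {n} α β = map (_↑ˡ n) α ++ map (m ↑ʳ_) β

module _ {m n} (α : Vec (Fin m) m) (β : Vec (Fin n) n) where

  lookup-⊕ˡ : ∀ s → lookup (α ⊕ β) (s ↑ˡ n) ≡ lookup α s ↑ˡ n
  lookup-⊕ˡ s = trans (lookup-++ˡ (map (_↑ˡ n) α) _ s) (lookup-map s _ α)

  lookup-⊕ʳ : ∀ t → lookup (α ⊕ β) (m ↑ʳ t) ≡ m ↑ʳ lookup β t
  lookup-⊕ʳ t = trans (lookup-++ʳ (map (_↑ˡ n) α) _ t) (lookup-map t _ β)

  IsPerm-⊕ : IsPerm α → IsPerm β → IsPerm (α ⊕ β)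
  IsPerm-⊕ α! β! x y eq with split m x | split m y
  ... | left s | left s′ =
    cong (_↑ˡ n) (α! s s′ (↑ˡ-injective n _ _ (trans (sym (lookup-⊕ˡ s)) (trans eq (lookup-⊕ˡ s′)))))
  ... | left s | right t′ = ⊥-elim (↑ˡ≢↑ʳ _ _ (trans (sym (lookup-⊕ˡ s)) (trans eq (lookup-⊕ʳ t′))))
  ... | right t | left s′ = ⊥-elim (↑ˡ≢↑ʳ _ _ (trans (sym (lookup-⊕ˡ s′)) (trans (sym eq) (lookup-⊕ʳ t))))
  ... | right t | right t′ =
    cong (m ↑ʳ_) (β! t t′ (↑ʳ-injective m _ _ (trans (sym (lookup-⊕ʳ t)) (trans eq (lookup-⊕ʳ t′)))))

  IsPerm-⊕⁻ : IsPerm (α ⊕ β) → IsPerm α × IsPerm β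
  IsPerm-⊕⁻ α⊕β! =
    (λ s s′ eq → ↑ˡ-injective n s s′ (α⊕β! _ _
       (trans (lookup-⊕ˡ s) (trans (cong (_↑ˡ n) eq) (sym (lookup-⊕ˡ s′)))))) ,
    (λ t t′ eq → ↑ʳ-injective m t t′ (α⊕β! _ _
       (trans (lookup-⊕ʳ t) (trans (cong (m ↑ʳ_) eq) (sym (lookup-⊕ʳ t′))))))

  SplitsAt-⊕ : SplitsAt m (α ⊕ β)
  SplitsAt-⊕ = below , above
    where
    below : ∀ x → toℕ x < m → (α ⊕ β) ⟨ x ⟩ < m
    below x x<m with split m x
    ... | left s = subst (_< m) (sym (trans (cong toℕ (lookup-⊕ˡ s)) (toℕ-↑ˡ _ n))) (toℕ<n _)
    ... | right t = ⊥-elim (↑ʳ≮ m t x<m)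
    above : ∀ x → m ≤ toℕ x → m ≤ (α ⊕ β) ⟨ x ⟩
    above x m≤x with split m x
    ... | left s = ⊥-elim (↑ˡ≱ s n m≤x)
    ... | right t = subst (m ≤_) (sym (trans (cong toℕ (lookup-⊕ʳ t)) (toℕ-↑ʳ m _))) (m≤m+n m _)

⊕-injective : {α α′ : Vec (Fin m) m} {β β′ : Vec (Fin n) n} → α ⊕ β ≡ α′ ⊕ β′ → α ≡ α′ × β ≡ β′
⊕-injective {m} {n} {α} {α′} eq with αs , βs ← ++-injective (map (_↑ˡ n) α) (map _ α′) eq =
  map-injective (↑ˡ-injective n _ _) αs , map-injective (↑ʳ-injective m _ _) βs

SplitsAt⇒⊕ : (π : Vec (Fin (m + n)) (m + n)) → SplitsAt m π →
             Σ (Vec (Fin m) m) λ α → Σ (Vec (Fin n) n) λ β → π ≡ α ⊕ β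
SplitsAt⇒⊕ {m} {n} π (below , above) = α , β , lookup-injective agree
  where
  left-part : ∀ s → Σ (Fin m) λ s′ → s′ ↑ˡ n ≡ lookup π (s ↑ˡ n)
  left-part s = ↑ˡ-onto _ (below _ (subst (_< m) (sym (toℕ-↑ˡ s n)) (toℕ<n s)))
  right-part : ∀ t → Σ (Fin n) λ t′ → m ↑ʳ t′ ≡ lookup π (m ↑ʳ t)
  right-part t = ↑ʳ-onto _ (above _ (subst (m ≤_) (sym (toℕ-↑ʳ m t)) (m≤m+n m _)))
  α : Vec (Fin m) m
  α = tabulate (proj₁ ∘ left-part)
  β : Vec (Fin n) n
  β = tabulate (proj₁ ∘ right-part)
  agree : ∀ x → lookup π x ≡ lookup (α ⊕ β) x
  agree x with split m x
  ... | left s = sym (trans (lookup-⊕ˡ α β s) (trans (cong (_↑ˡ n) (lookup∘tabulate _ s)) (proj₂ (left-part s))))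
  ... | right t = sym (trans (lookup-⊕ʳ α β t) (trans (cong (m ↑ʳ_) (lookup∘tabulate _ t)) (proj₂ (right-part t))))

-- Occurrences of p

Occurrence : List Box → Vec (Fin n) n → Fin n → Fin n → Set
Occurrence {n} R π i j =
  pos i < pos j × val π i < val π j ×
  ((box : Box) → box ∈ R → (x : Fin n) →
    ¬ InBox n (pos i) (pos j) (val π i) (val π j) box (pos x) (val π x))

-- In the paper's 1-based notation: i = 1, π₁ = k, j = k + 1 = π_j, and π maps {1, …, k} onto itself.
Layered : Vec (Fin n) n → Fin n → Fin n → Set
Layered π i j = toℕ i ≡ 0 × toℕ j ≡ suc (π ⟨ i ⟩) × π ⟨ j ⟩ ≡ toℕ j × SplitsAt (toℕ j) π

shaded₀₀ : (fz , fz) ∈ pR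
shaded₀₀ = here refl
shaded₀₁ : (fz , fs fz) ∈ pR
shaded₀₁ = there (here refl)
shaded₀₂ : (fz , fs (fs fz)) ∈ pR
shaded₀₂ = there (there (here refl))
shaded₁₁ : (fs fz , fs fz) ∈ pR
shaded₁₁ = there (there (there (here refl)))
shaded₁₂ : (fs fz , fs (fs fz)) ∈ pR
shaded₁₂ = there (there (there (there (here refl))))
shaded₂₀ : (fs (fs fz) , fz) ∈ pR
shaded₂₀ = there (there (there (there (there (here refl)))))
shaded₂₁ : (fs (fs fz) , fs fz) ∈ pR
shaded₂₁ = there (there (there (there (there (there (here refl))))))

≢⇒strip : ∀ {v V W} → v ≢ V → v ≢ W → v < V ⊎ (V < v × v < W) ⊎ W < v
≢⇒strip {v} {V} {W} v≢V v≢W with <-cmp v V | <-cmp v W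
... | tri< v<V _ _ | _ = inj₁ v<V
... | tri≈ _ v≡V _ | _ = ⊥-elim (v≢V v≡V)
... | tri> _ _ V<v | tri< v<W _ _ = inj₂ (inj₁ (V<v , v<W))
... | tri> _ _ _ | tri≈ _ v≡W _ = ⊥-elim (v≢W v≡W)
... | tri> _ _ _ | tri> _ _ W<v = inj₂ (inj₂ W<v)

module _ (π : Vec (Fin n) n) (π! : IsPerm π) {i j : Fin n} (occ : Occurrence pR π i j) where
  private
    I J V W : ℕ
    I = toℕ i
    J = toℕ j
    V = π ⟨ i ⟩
    W = π ⟨ j ⟩

    i<j : I < J
    i<j = s≤s⁻¹ (proj₁ occ)

    v<w : V < W
    v<w = s≤s⁻¹ (proj₁ (proj₂ occ))

    empty : ∀ {box} → box ∈ pR → (x : Fin n) → ¬ InBox n (suc I) (suc J) (suc V) (suc W) box (pos x) (val π x)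
    empty = proj₂ (proj₂ occ) _

    π⟨⟩-injective : ∀ {x y} → π ⟨ x ⟩ ≡ π ⟨ y ⟩ → x ≡ y
    π⟨⟩-injective eq = π! _ _ (toℕ-injective eq)

    distinct : ∀ {x y} → toℕ x ≢ toℕ y → π ⟨ x ⟩ ≢ π ⟨ y ⟩
    distinct x≢y = x≢y ∘ cong toℕ ∘ π⟨⟩-injective

    nothing-before : ∀ x → toℕ x < I → ⊥
    nothing-before x x<i with ≢⇒strip (distinct (<⇒≢ x<i)) (distinct (<⇒≢ (<-trans x<i i<j)))
    ... | inj₁ v<V = empty shaded₀₀ x ((z<s , s≤s x<i) , (z<s , s≤s v<V))
    ... | inj₂ (inj₁ (V<v , v<W)) = empty shaded₀₁ x ((z<s , s≤s x<i) , (s≤s V<v , s≤s v<W))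
    ... | inj₂ (inj₂ W<v) = empty shaded₀₂ x ((z<s , s≤s x<i) , (s≤s W<v , s≤s (toℕ<n _)))

    between : ∀ x → I < toℕ x → toℕ x < J → π ⟨ x ⟩ < V
    between x i<x x<j with ≢⇒strip (distinct (>⇒≢ i<x)) (distinct (<⇒≢ x<j))
    ... | inj₁ v<V = v<V
    ... | inj₂ (inj₁ (V<v , v<W)) = ⊥-elim (empty shaded₁₁ x ((s≤s i<x , s≤s x<j) , (s≤s V<v , s≤s v<W)))
    ... | inj₂ (inj₂ W<v) = ⊥-elim (empty shaded₁₂ x ((s≤s i<x , s≤s x<j) , (s≤s W<v , s≤s (toℕ<n _))))

    after : ∀ x → J < toℕ x → W < π ⟨ x ⟩
    after x j<x with ≢⇒strip (distinct (>⇒≢ (<-trans i<j j<x))) (distinct (>⇒≢ j<x))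
    ... | inj₁ v<V = ⊥-elim (empty shaded₂₀ x ((s≤s j<x , s≤s (toℕ<n x)) , (z<s , s≤s v<V)))
    ... | inj₂ (inj₁ (V<v , v<W)) = ⊥-elim (empty shaded₂₁ x ((s≤s j<x , s≤s (toℕ<n x)) , (s≤s V<v , s≤s v<W)))
    ... | inj₂ (inj₂ W<v) = W<v

    before-j : ∀ x → toℕ x < J → π ⟨ x ⟩ ≤ V
    before-j x x<j with <-cmp I (toℕ x)
    ... | tri< i<x _ _ = <⇒≤ (between x i<x x<j)
    ... | tri≈ _ i≡x _ = ≤-reflexive (cong (π ⟨_⟩) (sym (toℕ-injective i≡x)))
    ... | tri> _ _ x<i = ⊥-elim (nothing-before x x<i)

    i≡0 : I ≡ 0
    i≡0 = n≤0⇒n≡0 (≮⇒≥ λ 0<i → nothing-before (fromℕ< (<-trans 0<i (toℕ<n i)))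
                                                 (subst (_< I) (sym (toℕ-fromℕ< _)) 0<i))

    j≤1+v : J ≤ suc V
    j≤1+v = interval-injection-≤ {lo = 0} {lo′ = 0} (π ⟨_⟩) π⟨⟩-injective (<⇒≤ (toℕ<n j))
              λ x _ x<j → z≤n , s≤s (before-j x x<j)

    w≤j : W ≤ J
    w≤j = s≤s⁻¹ (∸-cancelʳ-≤ (toℕ<n (lookup π j))
            (interval-injection-≤ (π ⟨_⟩) π⟨⟩-injective ≤-refl λ x j<x _ → after x j<x , toℕ<n _))

    j≡1+v : J ≡ suc V
    j≡1+v = ≤-antisym j≤1+v (≤-trans v<w w≤j)

    w≡j : W ≡ J
    w≡j = ≤-antisym w≤j (≤-trans j≤1+v v<w)

    splits : SplitsAt J π
    splits = (λ x x<j → subst (π ⟨ x ⟩ <_) (sym j≡1+v) (s≤s (before-j x x<j))) , from-j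
      where
      from-j : ∀ x → J ≤ toℕ x → J ≤ π ⟨ x ⟩
      from-j x j≤x with m≤n⇒m<n∨m≡n j≤x
      ... | inj₁ j<x = subst (_≤ π ⟨ x ⟩) w≡j (<⇒≤ (after x j<x))
      ... | inj₂ j≡x = ≤-reflexive (trans (sym w≡j) (cong (π ⟨_⟩) (toℕ-injective j≡x)))

  occurrence⇒layered : Layered π i j
  occurrence⇒layered = i≡0 , j≡1+v , w≡j , splits

layered⇒occurrence : (π : Vec (Fin n) n) {i j : Fin n} → Layered π i j → Occurrence pR π i j
layered⇒occurrence π {i} {j} (i≡0 , j≡1+v , w≡j , below , above) =
  s≤s (subst₂ _<_ (sym i≡0) (sym j≡1+v) z<s) , s≤s (subst (π ⟨ i ⟩ <_) (sym w≡1+v) ≤-refl) , empty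
  where
  w≡1+v : π ⟨ j ⟩ ≡ suc (π ⟨ i ⟩)
  w≡1+v = trans w≡j j≡1+v
  nothing-before : ∀ x → toℕ x < toℕ i → ⊥
  nothing-before x x<i = n≮0 (subst (toℕ x <_) i≡0 x<i)
  nothing-between : ∀ x → π ⟨ i ⟩ < π ⟨ x ⟩ → π ⟨ x ⟩ < π ⟨ j ⟩ → ⊥
  nothing-between x v<x x<w = <⇒≱ x<w (subst (_≤ π ⟨ x ⟩) (sym w≡1+v) v<x)
  empty : (box : Box) → box ∈ pR → (x : Fin _) →
          ¬ InBox _ (pos i) (pos j) (val π i) (val π j) box (pos x) (val π x)
  empty _ (here refl) x ((_ , s≤s x<i) , _) = nothing-before x x<i
  empty _ (there (here refl)) x ((_ , s≤s x<i) , _) = nothing-before x x<i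
  empty _ (there (there (here refl))) x ((_ , s≤s x<i) , _) = nothing-before x x<i
  empty _ (there (there (there (here refl)))) x (_ , (s≤s v<x , s≤s x<w)) = nothing-between x v<x x<w
  empty _ (there (there (there (there (here refl))))) x ((_ , s≤s x<j) , (s≤s w<x , _)) =
    <-asym (below x x<j) (subst (_< π ⟨ x ⟩) w≡j w<x)
  empty _ (there (there (there (there (there (here refl)))))) x ((s≤s j<x , _) , (_ , s≤s x<v)) =
    <⇒≱ (<-trans x<v (subst (π ⟨ i ⟩ <_) (sym j≡1+v) ≤-refl)) (above x (<⇒≤ j<x))
  empty _ (there (there (there (there (there (there (here refl))))))) x (_ , (s≤s v<x , s≤s x<w)) =
    nothing-between x v<x x<w
  empty _ (there (there (there (there (there (there (there ()))))))) _

-- Permutations with first entry k that contain p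

head-⊕ˡ : (α : Vec (Fin (suc m)) (suc m)) (β : Vec (Fin n) n) → (α ⊕ β) ⟨ fz ⟩ ≡ toℕ (head α)
head-⊕ˡ {n = n} α@(v ∷ _) β = trans (cong toℕ (lookup-⊕ˡ α β fz)) (toℕ-↑ˡ v n)

head-⊕ʳ : (α : Vec (Fin m) m) (β : Vec (Fin (suc n)) (suc n)) → (α ⊕ β) ⟨ m ↑ʳ fz ⟩ ≡ m + toℕ (head β)
head-⊕ʳ {m} α β@(v ∷ _) = trans (cong toℕ (lookup-⊕ʳ α β fz)) (toℕ-↑ʳ m v)

-- In one-line notation (1-based) this is  a+1, σ, a+2, τ shifted up by a+2.
assemble : ∀ {a b} → Vec (Fin a) a → Vec (Fin b) b → Vec (Fin (suc a + suc b)) (suc a + suc b)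
assemble {a} σ τ = prepend (fromℕ a) σ ⊕ prepend fz τ

module _ {a b : ℕ} where

  assemble-injective : {σ σ′ : Vec (Fin a) a} {τ τ′ : Vec (Fin b) b} →
                       assemble σ τ ≡ assemble σ′ τ′ → σ ≡ σ′ × τ ≡ τ′
  assemble-injective eq with σs , τs ← ⊕-injective eq =
    proj₂ (prepend-injective σs) , proj₂ (prepend-injective τs)

  IsPerm-assemble : {σ : Vec (Fin a) a} {τ : Vec (Fin b) b} → IsPerm σ → IsPerm τ → IsPerm (assemble σ τ)
  IsPerm-assemble {σ} {τ} σ! τ! =
    IsPerm-⊕ (prepend (fromℕ a) σ) (prepend fz τ) (IsPerm-prepend (fromℕ a) σ!) (IsPerm-prepend fz τ!)

  assemble-first : (σ : Vec (Fin a) a) (τ : Vec (Fin b) b) → assemble σ τ ⟨ fz ⟩ ≡ a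
  assemble-first σ τ = trans (head-⊕ˡ (prepend (fromℕ a) σ) (prepend fz τ)) (toℕ-fromℕ a)

  Layered-assemble : (σ : Vec (Fin a) a) (τ : Vec (Fin b) b) → Layered (assemble σ τ) fz (suc a ↑ʳ fz)
  Layered-assemble σ τ =
    refl ,
    trans position (cong suc (sym (assemble-first σ τ))) ,
    trans (head-⊕ʳ (prepend (fromℕ a) σ) (prepend fz τ)) (sym (toℕ-↑ʳ (suc a) fz)) ,
    subst (λ m → SplitsAt m (assemble σ τ)) (sym position) (SplitsAt-⊕ (prepend (fromℕ a) σ) (prepend fz τ))
    where
    position : toℕ (suc a ↑ʳ fz {b}) ≡ suc a
    position = trans (toℕ-↑ʳ (suc a) fz) (+-identityʳ (suc a))

  Layered⇒assemble : (π : Vec (Fin (suc a + suc b)) (suc a + suc b)) {j : Fin (suc a + suc b)} →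
    IsPerm π → π ⟨ fz ⟩ ≡ a → Layered π fz j →
    Σ (Vec (Fin a) a) λ σ → Σ (Vec (Fin b) b) λ τ → IsPerm σ × IsPerm τ × π ≡ assemble σ τ
  Layered⇒assemble π {j} π! π⟨0⟩≡a (_ , j≡1+a , π⟨j⟩≡j , splits)
    with SplitsAt⇒⊕ π (subst (λ m → SplitsAt m π) (trans j≡1+a (cong suc π⟨0⟩≡a)) splits)
  ... | α , β , refl with IsPerm-⊕⁻ α β π!
  ... | α! , β! with prepend-tail α α! | prepend-tail β β!
  ... | σ , σ! , α≡ | τ , τ! , β≡ =
    σ , τ , σ! , τ! , cong₂ _⊕_ (trans α≡ (cong (λ v → prepend v σ) head-α))
                                (trans β≡ (cong (λ v → prepend v τ) head-β))
    where
    head-α : head α ≡ fromℕ a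
    head-α = toℕ-injective (trans (sym (head-⊕ˡ α β)) (trans π⟨0⟩≡a (sym (toℕ-fromℕ a))))
    j≡ : j ≡ suc a ↑ʳ fz
    j≡ = toℕ-injective (trans j≡1+a (trans (cong suc π⟨0⟩≡a)
           (sym (trans (toℕ-↑ʳ (suc a) fz) (+-identityʳ (suc a))))))
    head-β : head β ≡ fz
    head-β = toℕ-injective (+-cancelˡ-≡ (suc a) _ _ (begin
      suc a + toℕ (head β)            ≡⟨ head-⊕ʳ α β ⟨
      (α ⊕ β) ⟨ suc a ↑ʳ fz ⟩         ≡⟨ cong ((α ⊕ β) ⟨_⟩) j≡ ⟨
      (α ⊕ β) ⟨ j ⟩                   ≡⟨ trans π⟨j⟩≡j (cong toℕ j≡) ⟩
      toℕ (suc a ↑ʳ fz {b})           ≡⟨ toℕ-↑ʳ (suc a) fz ⟩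
      suc a + 0                       ∎))
      where open ≡-Reasoning

ContainingWithFirst : (n k : ℕ) → Vec (Fin n) n → Set
ContainingWithFirst n k π = IsPerm π × FirstIs π k × Contains pR π

HasCard-assembled : ∀ a b → HasCard (ContainingWithFirst (suc a + suc b) (suc a)) (a ! * b !)
HasCard-assembled a b =
  HasCard-image₂ assemble assemble-injective into onto (permutations a) (permutations b)
  where
  into : ∀ σ τ → IsPerm σ → IsPerm τ → ContainingWithFirst _ (suc a) (assemble σ τ)
  into σ τ σ! τ! =
    IsPerm-assemble σ! τ! , (fz , refl , cong suc (assemble-first σ τ)) ,
    fz , suc a ↑ʳ fz , layered⇒occurrence (assemble σ τ) (Layered-assemble σ τ)
  onto : ∀ π → ContainingWithFirst _ (suc a) π →
         Σ (Vec (Fin a) a) λ σ → Σ (Vec (Fin b) b) λ τ → IsPerm σ × IsPerm τ × π ≡ assemble σ τ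
  onto π (π! , (x , x≡0 , π⟨x⟩≡a) , i , j , occ)
    with refl ← toℕ-injective {j = fz} x≡0
       | refl ← toℕ-injective {j = fz} (proj₁ (occurrence⇒layered π π! occ)) =
    Layered⇒assemble π π! (suc-injective π⟨x⟩≡a) (occurrence⇒layered π π! occ)

1+a≤n∸1⇒∃[b]1+a+1+b≡n : ∀ {a n} → suc a ≤ n ∸ 1 → ∃ λ b → suc a + suc b ≡ n
1+a≤n∸1⇒∃[b]1+a+1+b≡n {a} {suc n} a<n with b , a+b≡n ← m≤n⇒∃[o]m+o≡n a<n =
  b , trans (+-suc (suc a) b) (cong suc a+b≡n)

HasCard-containingWithFirst : ∀ n k → 1 ≤ k → k ≤ n ∸ 1 →
                              HasCard (ContainingWithFirst n k) ((k ∸ 1) ! * (n ∸ k ∸ 1) !)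
HasCard-containingWithFirst n (suc a) _ k≤n∸1 with b , refl ← 1+a≤n∸1⇒∃[b]1+a+1+b≡n {n = n} k≤n∸1 =
  subst (HasCard _) (cong (λ m → a ! * (m ∸ 1) !) (sym (m+n∸m≡n (suc a) (suc b)))) (HasCard-assembled a b)

first-entry : (π : Vec (Fin n) n) → IsPerm π → Contains pR π →
              Σ ℕ λ k → 1 ≤ k × k < 1 + (n ∸ 1) × FirstIs π k
first-entry π π! (i , j , occ) with i≡0 , j≡1+v , _ ← occurrence⇒layered π π! occ =
  suc (π ⟨ i ⟩) , s≤s z≤n , s≤s (<⇒≤pred (subst (_< _) j≡1+v (toℕ<n j))) , i , i≡0 , refl

HasCard-containing : ∀ n → HasCard (λ (π : Vec (Fin n) n) → IsPerm π × Contains pR π)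
                                       (sumRange 1 (n ∸ 1) λ k → (k ∸ 1) ! * (n ∸ k ∸ 1) !)
HasCard-containing n =
  HasCard-cong (λ _ (_ , _ , _ , π! , _ , c) → π! , c)
    (λ π (π! , c) → let k , 1≤k , k<n , first = first-entry π π! c in k , 1≤k , k<n , π! , first , c)
    (HasCard-sumFrom (ContainingWithFirst n) _ (λ {_} {_} {π} → first-determined π) 1 (n ∸ 1)
      λ k 1≤k k<n → HasCard-containingWithFirst n k 1≤k (s≤s⁻¹ k<n))
  where
  first-determined : ∀ {k k′} (π : Vec (Fin n) n) →
                     ContainingWithFirst n k π → ContainingWithFirst n k′ π → k ≡ k′
  first-determined π (_ , (x , x≡0 , π⟨x⟩≡k) , _) (_ , (x′ , x′≡0 , π⟨x′⟩≡k′) , _) =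
    trans (sym π⟨x⟩≡k) (trans (cong (val π) (toℕ-injective (trans x≡0 (sym x′≡0)))) π⟨x′⟩≡k′)

proposition4p14 : (n : ℕ) → 2 ≤ n →
    ((k : ℕ) → 1 ≤ k → k ≤ n ∸ 1 →
      HasCard (λ (π : Vec (Fin n) n) → IsPerm π × FirstIs π k × Contains pR π)
        (((k ∸ 1) !) * ((n ∸ k ∸ 1) !)))
    ×
    HasCard (λ (π : Vec (Fin n) n) → IsPerm π × ¬ Contains pR π)
      ((n !) ∸ sumRange 1 (n ∸ 1) (λ k → ((k ∸ 1) !) * ((n ∸ k ∸ 1) !)))
proposition4p14 n _ =
  HasCard-containingWithFirst n , HasCard-∖ (≡-dec _≟ᶠ_) (permutations n) (HasCard-containing n)
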